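{- Let $\mathcal{G}$ be a proper minor-closed family of graphs. There is a constant $c(\mathcal{G})$ depending only on $\mathcal{G}$ such that, whenever the primal-dual algorithm with reverse-delete described in the context is run on a graph $G\in\mathcal{G}$ with costs $c:V\to\mathbb{R}_{\ge0}$, for each iteration $i$ of the algorithm we have $\sum_{u\in A_i}|W_i\cap\Gamma^+(u)|\le c(\mathcal{G})\cdot|A_i|$, where $W_i=Y-X_{i-1}$.
   Context: $\Gamma(v)$ is the neighbor set of $v$ and $\Gamma^+(v)=\Gamma(v)\cup\{v\}$; a set $D$ is dominating if $D\cap\Gamma^+(v)\neq\emptyset$ for all $v$. Primal-dual algorithm: start with $X_0=\{v:c(v)=0\}$ and $y(v)=0$ for all $v$. In iteration $i=1,2,\dots$: let $A_i=\{v\in V: X_{i-1}\cap\Gamma^+(v)=\emptyset\}$. If $A_i=\emptyset$, stop and set $X=X_{i-1}$. Otherwise increase all $y(a)$, $a\in A_i$, uniformly until for some vertex $v$ the constraint $\sum_{u\in\Gamma^+(v)}y(u)\le c(v)$ becomes tight; let $X_i$ be $X_{i-1}$ together with all vertices whose constraint is tight. Reverse-delete: set $Y=X$ and consider the vertices of $X$ in the reverse of the order in which they were added to $X$ (a fixed linear order consistent with the iterations); for the current vertex $v$, if $Y-v$ is a dominating set, remove $v$ from $Y$. A family is minor-closed if closed under taking minors, and proper if it does not contain all graphs.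
   Formalization: The costs $c$ take nonnegative rational values rather than nonnegative real ones. -}

module Defs where

open import Data.Nat as ℕ using (ℕ; zero; suc)
open import Data.Fin as Fin using (Fin; _≟_)
open import Data.Bool using (Bool; true; false; _∧_; _∨_; not; if_then_else_)
open import Data.List using (List; []; _∷_; map; foldr; allFin; length; lookup; reverse)
open import Data.Bool.ListAction using (any; all)
open import Data.Nat.ListAction using (sum)
import Data.List as L
open import Data.List.Membership.Propositional using (_∈_)
open import Data.List.Relation.Unary.Unique.Propositional using (Unique)
open import Data.Rational using (ℚ; 0ℚ; _+_; _≤_; _<_)
open import Data.Product using (Σ; ∃; ∃-syntax; _×_)
open import Data.Sum using (_⊎_)
open import Relation.Binary.PropositionalEquality using (_≡_; _≢_)
open import Relation.Nullary using (¬_; does)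
open import Function.Bundles using (_⇔_)

record Graph (n : ℕ) : Set where
  field
    adj   : Fin n → Fin n → Bool
    sym   : ∀ u v → adj u v ≡ adj v u
    irrefl : ∀ v → adj v v ≡ false
open Graph public

VSet : ℕ → Set
VSet n = Fin n → Bool

anyV : ∀ {n} → (Fin n → Bool) → Bool
anyV {n} p = any p (allFin n)

allV : ∀ {n} → (Fin n → Bool) → Bool
allV {n} p = all p (allFin n)

card : ∀ {n} → VSet n → ℕ
card {n} S = sum (map (λ v → if S v then 1 else 0) (allFin n))

Γ⁺ : ∀ {n} → Graph n → Fin n → VSet n
Γ⁺ G v u = does (v ≟ u) ∨ adj G v u

_∩_ : ∀ {n} → VSet n → VSet n → VSet n
(S ∩ T) v = S v ∧ T v

_─_ : ∀ {n} → VSet n → VSet n → VSet n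
(S ─ T) v = S v ∧ not (T v)

isDominating : ∀ {n} → Graph n → VSet n → Bool
isDominating G D = allV (λ v → anyV (D ∩ Γ⁺ G v))

data WalkIn {n} (G : Graph n) (S : VSet n) : Fin n → Fin n → Set where
  stop : ∀ {v} → S v ≡ true → WalkIn G S v v
  step : ∀ {u w v} → S u ≡ true → adj G u w ≡ true → WalkIn G S w v → WalkIn G S u v

record MinorModel {m n} (H : Graph m) (G : Graph n) : Set where
  field
    branch    : Fin m → VSet n
    nonempty  : ∀ i → ∃[ v ] branch i v ≡ true
    disjoint  : ∀ i j v → i ≢ j → branch i v ≡ true → branch j v ≡ false
    connected : ∀ i u v → branch i u ≡ true → branch i v ≡ true → WalkIn G (branch i) u v
    edges     : ∀ i j → adj H i j ≡ true →
                ∃[ u ] ∃[ v ] (branch i u ≡ true × branch j v ≡ true × adj G u v ≡ true)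

_≼_ : ∀ {m n} → Graph m → Graph n → Set
H ≼ G = MinorModel H G

Family : Set₁
Family = ∀ n → Graph n → Set

MinorClosed : Family → Set
MinorClosed 𝒢 = ∀ {m n} (H : Graph m) (G : Graph n) → 𝒢 n G → H ≼ G → 𝒢 m H

Proper : Family → Set
Proper 𝒢 = ∃[ m ] Σ (Graph m) (λ H → ¬ 𝒢 m H)

sumV : ∀ {n} → (Fin n → ℚ) → ℚ
sumV {n} f = foldr _+_ 0ℚ (map f (allFin n))

sumVℕ : ∀ {n} → (Fin n → ℕ) → ℕ
sumVℕ {n} f = sum (map f (allFin n))

load : ∀ {n} → Graph n → (Fin n → ℚ) → Fin n → ℚ
load G y v = sumV (λ u → if Γ⁺ G v u then y u else 0ℚ)

Feasible : ∀ {n} → Graph n → (Fin n → ℚ) → (Fin n → ℚ) → Set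
Feasible G c y = ∀ v → load G y v ≤ c v

Active : ∀ {n} → Graph n → VSet n → VSet n
Active G X v = not (anyV (X ∩ Γ⁺ G v))

raise : ∀ {n} → VSet n → (Fin n → ℚ) → ℚ → Fin n → ℚ
raise A y δ a = if A a then y a + δ else y a

record Step {n} (G : Graph n) (c : Fin n → ℚ) (X : VSet n) (y : Fin n → ℚ)
            (X' : VSet n) (y' : Fin n → ℚ) : Set where
  field
    active-nonempty : ∃[ v ] Active G X v ≡ true
    δ        : ℚ
    y'-def   : ∀ a → y' a ≡ raise (Active G X) y δ a
    feasible : Feasible G c y'
    maximal  : ∀ δ' → δ < δ' → ¬ Feasible G c (raise (Active G X) y δ')
    X'-def   : ∀ v → (X' v ≡ true) ⇔ (X v ≡ true ⊎ load G y' v ≡ c v)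

-- a complete run of the primal phase: iterations 1..k, X i = X_i, y i = y after i iterations
record Run {n} (G : Graph n) (c : Fin n → ℚ) : Set where
  field
    k     : ℕ
    X     : ℕ → VSet n
    y     : ℕ → Fin n → ℚ
    X₀    : ∀ v → (X 0 v ≡ true) ⇔ (c v ≡ 0ℚ)
    y₀    : ∀ v → y 0 v ≡ 0ℚ
    steps : ∀ i → i ℕ.< k → Step G c (X i) (y i) (X (suc i)) (y (suc i))
    halt  : ∀ v → Active G (X k) v ≡ false
open Run public

record ConsistentOrder {n} {G : Graph n} {c : Fin n → ℚ} (R : Run G c) (ord : List (Fin n)) : Set where
  field
    unique     : Unique ord
    complete   : ∀ v → (v ∈ ord) ⇔ (X R (k R) v ≡ true)
    consistent : ∀ (p q : Fin (length ord)) → p Fin.< q → ∀ i →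
                 X R i (lookup ord q) ≡ true → X R i (lookup ord p) ≡ true

remove : ∀ {n} → VSet n → Fin n → VSet n
remove Y v u = Y u ∧ not (does (v ≟ u))

reverseDelete' : ∀ {n} → Graph n → VSet n → List (Fin n) → VSet n
reverseDelete' G Y [] = Y
reverseDelete' G Y (v ∷ vs) =
  reverseDelete' G (if isDominating G (remove Y v) then remove Y v else Y) vs

reverseDelete : ∀ {n} {G : Graph n} {c : Fin n → ℚ} → Run G c → List (Fin n) → VSet n
reverseDelete {G = G} R ord = reverseDelete' G (X R (k R)) (reverse ord)

{-# OPTIONS --safe #-}
-- Reverse-delete keeps a vertex w ∈ W = Y − X_{i−1} only because, when w is considered, some
-- vertex v sees no other vertex of the current set; the vertices of X_{i−1} were added before w,
-- so they are all still present then, hence v sees none of them (v is active) and v determines w.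
-- Contracting each w ∈ W − A_i into its private neighbour gives a minor of G on the vertex set A_i
-- in which every w ∈ W ∩ Γ⁺(u) lies in the branch set of u or of a neighbour of u, and every branch
-- set contains at most two vertices of W. So the sum is at most 2|A_i| + 2 Σ deg, and since the
-- minor lies in 𝒢 it has no H-minor for a fixed H ∉ 𝒢, so Mader's theorem bounds Σ deg by c(H)|A_i|.
module Submission where

open import Defs hiding (sym)
open import Data.Nat using (ℕ; zero; suc; _+_; _*_; _≤_; _<_; _<?_; _≤?_; z≤n; s≤s; pred)
open import Data.Nat.Properties hiding (_≟_; ≡ᵇ⇒≡)
open import Data.Nat.Induction using (<-wellFounded)
open import Data.Nat.Solver using (module +-*-Solver)
import Data.Nat.ListAction
open import Data.Fin as Fin using (Fin; _≟_)
import Data.Fin.Properties as Finₚ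
open import Data.Bool using (Bool; true; false; _∧_; _∨_; not; if_then_else_)
import Data.Bool.Properties as Boolₚ
open import Data.Bool.ListAction using (any; all)
open import Data.List using (List; []; _∷_; _++_; [_]; allFin; map; tabulate; reverse; length; lookup)
import Data.List.Properties as Listₚ
open import Data.List.Membership.Propositional using (_∈_; _∉_)
open import Data.List.Membership.Propositional.Properties using (∈-allFin; ∈-∃++)
open import Data.List.Relation.Unary.Any using (here; there; index)
open import Data.List.Relation.Unary.Any.Properties using (lookup-index; reverse⁺)
open import Data.Rational using (ℚ; 0ℚ)
import Data.Rational as Q
open import Data.Product using (∃-syntax; _×_; _,_; proj₁; proj₂)
open import Data.Sum using (_⊎_; inj₁; inj₂)
open import Data.Empty using (⊥-elim)
open import Function using (_∘_; id)
open import Function.Bundles using (Equivalence)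
open import Induction.WellFounded using (Acc; acc)
open import Relation.Binary.PropositionalEquality
  using (_≡_; _≢_; refl; sym; trans; cong; cong₂; subst; subst₂; module ≡-Reasoning)
open import Relation.Nullary using (¬_; does; yes; no; Dec)
open import Relation.Nullary.Decidable using (dec-true; dec-false; _×-dec_)
open import Algebra.Properties.Semiring.Sum +-*-semiring
  using (sum; sum-syntax; ∑-distrib-+; ∑-comm; sum-cong-≗; sum-replicate-zero; *-distribʳ-sum)

infix 7 _==_

_==_ : ∀ {n} → Fin n → Fin n → Bool
x == y = does (x ≟ y)

==-refl : ∀ {n} (x : Fin n) → (x == x) ≡ true
==-refl x = dec-true (x ≟ x) refl

==⇒≡ : ∀ {n} {x y : Fin n} → (x == y) ≡ true → x ≡ y
==⇒≡ {x = x} {y} e with x ≟ y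
... | yes x≡y = x≡y

≢⇒==-false : ∀ {n} {x y : Fin n} → x ≢ y → (x == y) ≡ false
≢⇒==-false {x = x} {y} = dec-false (x ≟ y)

not-==⇒≢ : ∀ {n} {x y : Fin n} → not (x == y) ≡ true → x ≢ y
not-==⇒≢ {x = x} e refl with () ← trans (sym (cong not (==-refl x))) e

==-sym : ∀ {n} (x y : Fin n) → (x == y) ≡ (y == x)
==-sym x y with x ≟ y | y ≟ x
... | yes _   | yes _   = refl
... | no  _   | no  _   = refl
... | yes x≡y | no  y≢x = ⊥-elim (y≢x (sym x≡y))
... | no  x≢y | yes y≡x = ⊥-elim (x≢y (sym y≡x))

∧-true⇒ : ∀ {x y} → x ∧ y ≡ true → x ≡ true × y ≡ true
∧-true⇒ {true} {true} _ = refl , refl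

∧-intro : ∀ {x y} → x ≡ true → y ≡ true → x ∧ y ≡ true
∧-intro refl refl = refl

∨-true⇒ : ∀ {x y} → x ∨ y ≡ true → x ≡ true ⊎ y ≡ true
∨-true⇒ {true}         _ = inj₁ refl
∨-true⇒ {false} {true} _ = inj₂ refl

not-true⇒ : ∀ {x} → not x ≡ true → x ≡ false
not-true⇒ {false} _ = refl

not-false⇒ : ∀ {x} → not x ≡ false → x ≡ true
not-false⇒ {true} _ = refl

true≢false : true ≢ false
true≢false ()

𝟙 : Bool → ℕ
𝟙 b = if b then 1 else 0

𝟙≤1 : ∀ b → 𝟙 b ≤ 1
𝟙≤1 true  = ≤-refl
𝟙≤1 false = z≤n

𝟙-pos : ∀ {b} → 0 < 𝟙 b → b ≡ true
𝟙-pos {true} _ = refl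

𝟙-true : ∀ {b} → b ≡ true → 𝟙 b ≡ 1
𝟙-true refl = refl

1≤𝟙+ : ∀ {x n} → x ≡ true → 1 ≤ 𝟙 x + n
1≤𝟙+ refl = s≤s z≤n

1≤+𝟙 : ∀ {m x} → x ≡ true → 1 ≤ m + 𝟙 x
1≤+𝟙 {m} refl = m≤n+m 1 m

𝟙+𝟙≤2 : ∀ p q → 𝟙 p + 𝟙 q ≤ 2
𝟙+𝟙≤2 p q = +-mono-≤ (𝟙≤1 p) (𝟙≤1 q)

𝟙-∨+𝟙-∧ : ∀ p q → 𝟙 p + 𝟙 q ≡ 𝟙 (p ∨ q) + 𝟙 (p ∧ q)
𝟙-∨+𝟙-∧ true  true  = refl
𝟙-∨+𝟙-∧ true  false = refl
𝟙-∨+𝟙-∧ false true  = refl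
𝟙-∨+𝟙-∧ false false = refl

module _ {n : ℕ} where

  sumVℕ≡∑ : (f : Fin n → ℕ) → sumVℕ f ≡ ∑[ x < n ] f x
  sumVℕ≡∑ f = over-tabulate n id
    where
    over-tabulate : ∀ m (g : Fin m → Fin n) → Data.Nat.ListAction.sum (map f (tabulate g)) ≡ ∑[ x < m ] f (g x)
    over-tabulate zero    g = refl
    over-tabulate (suc m) g = cong (f (g Fin.zero) +_) (over-tabulate m (g ∘ Fin.suc))

  card≡∑ : (S : VSet n) → card S ≡ ∑[ x < n ] 𝟙 (S x)
  card≡∑ S = sumVℕ≡∑ (𝟙 ∘ S)

∑-mono-≤ : ∀ {n} {f g : Fin n → ℕ} → (∀ x → f x ≤ g x) → sum f ≤ sum g
∑-mono-≤ {zero}  f≤g = z≤n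
∑-mono-≤ {suc n} f≤g = +-mono-≤ (f≤g Fin.zero) (∑-mono-≤ (f≤g ∘ Fin.suc))

∑-*ʳ : ∀ {n} (f : Fin n → ℕ) k → ∑[ x < n ] (f x * k) ≡ sum f * k
∑-*ʳ f k = sym (*-distribʳ-sum k f)

∑-*ˡ : ∀ {n} k (f : Fin n → ℕ) → ∑[ x < n ] (k * f x) ≡ k * sum f
∑-*ˡ k f = trans (sum-cong-≗ (λ x → *-comm k (f x))) (trans (∑-*ʳ f k) (*-comm (sum f) k))

∑-δ : ∀ {n} (a : Fin n) k → ∑[ x < n ] (𝟙 (x == a) * k) ≡ k
∑-δ {suc n} Fin.zero    k = trans (cong (k + 0 +_) (sum-replicate-zero n)) (trans (+-identityʳ _) (+-identityʳ k))
∑-δ {suc n} (Fin.suc a) k = ∑-δ a k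

∑-δ₁ : ∀ {n} (a : Fin n) → ∑[ x < n ] 𝟙 (x == a) ≡ 1
∑-δ₁ a = trans (sum-cong-≗ (λ x → sym (*-identityʳ (𝟙 (x == a))))) (∑-δ a 1)

≤∑ : ∀ {n} (f : Fin n → ℕ) a → f a ≤ sum f
≤∑ f a = subst (_≤ sum f) (∑-δ a (f a)) (∑-mono-≤ δ≤f)
  where
  δ≤f : ∀ x → 𝟙 (x == a) * f a ≤ f x
  δ≤f x with x ≟ a
  ... | yes refl = ≤-reflexive (+-identityʳ (f x))
  ... | no  _    = z≤n

∑-pos⇒∃-pos : ∀ {n} (f : Fin n → ℕ) → 0 < sum f → ∃[ x ] 0 < f x
∑-pos⇒∃-pos {suc n} f pos with f Fin.zero in eq
... | suc _ = Fin.zero , subst (0 <_) (sym eq) (s≤s z≤n)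
... | zero  with ∑-pos⇒∃-pos (f ∘ Fin.suc) pos
... | x , fx>0 = Fin.suc x , fx>0

card-subsingleton : ∀ {n} (S : Fin n → Bool) → (∀ x y → S x ≡ true → S y ≡ true → x ≡ y) →
                    ∑[ x < n ] 𝟙 (S x) ≤ 1
card-subsingleton {n} S unique with Finₚ.any? (λ x → S x Boolₚ.≟ true)
... | yes (a , Sa) = subst (∑[ x < n ] 𝟙 (S x) ≤_) (∑-δ₁ a) (∑-mono-≤ S⊆a)
  where
  S⊆a : ∀ x → 𝟙 (S x) ≤ 𝟙 (x == a)
  S⊆a x with S x in Sx
  ... | false = z≤n
  ... | true  = ≤-reflexive (sym (𝟙-true (trans (cong (_== a) (unique x a Sx Sa)) (==-refl a))))
... | no  ∄a = subst (_≤ 1) (sym (trans (sum-cong-≗ S-empty) (sum-replicate-zero n))) z≤n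
  where
  S-empty : ∀ x → 𝟙 (S x) ≡ 0
  S-empty x with S x in Sx
  ... | false = refl
  ... | true  = ⊥-elim (∄a (x , Sx))

∑-mono-≤-off-pair : ∀ {n} {f g : Fin n → ℕ} (a b : Fin n) → a ≢ b →
                    (∀ x → x ≢ a → x ≢ b → f x ≤ g x) → f a + f b ≤ g a + g b →
                    sum f ≤ sum g
∑-mono-≤-off-pair {n} {f} {g} a b a≢b off on =
  +-cancelʳ-≤ (f b + g b) (sum f) (sum g)
    (subst₂ _≤_ (shift f (f b) (g b)) (shift+ g (g b) (f b)) (∑-mono-≤ pointwise))
  where
  -- move f b into the summand at a, and compensate with g b at b
  F G : Fin n → ℕ
  F x = f x + 𝟙 (x == a) * f b + 𝟙 (x == b) * g b
  G x = g x + 𝟙 (x == a) * g b + 𝟙 (x == b) * f b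
  shift : ∀ h p q → sum (λ x → h x + 𝟙 (x == a) * p + 𝟙 (x == b) * q) ≡ sum h + (p + q)
  shift h p q = begin
    sum (λ x → h x + 𝟙 (x == a) * p + 𝟙 (x == b) * q)
      ≡⟨ ∑-distrib-+ (λ x → h x + 𝟙 (x == a) * p) _ ⟩
    sum (λ x → h x + 𝟙 (x == a) * p) + sum (λ x → 𝟙 (x == b) * q)
      ≡⟨ cong₂ _+_ (trans (∑-distrib-+ h _) (cong (sum h +_) (∑-δ a p))) (∑-δ b q) ⟩
    sum h + p + q
      ≡⟨ +-assoc (sum h) p q ⟩
    sum h + (p + q) ∎
    where open ≡-Reasoning
  shift+ : ∀ h p q → sum (λ x → h x + 𝟙 (x == a) * p + 𝟙 (x == b) * q) ≡ sum h + (q + p)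
  shift+ h p q = trans (shift h p q) (cong (sum h +_) (+-comm p q))
  at-a : ∀ p q r → p + 𝟙 true * q + 𝟙 false * r ≡ p + q
  at-a p q r = trans (+-identityʳ (p + 1 * q)) (cong (p +_) (*-identityˡ q))
  at-b : ∀ p q r → p + 𝟙 false * q + 𝟙 true * r ≡ p + r
  at-b p q r = cong₂ _+_ (+-identityʳ p) (*-identityˡ r)
  pointwise : ∀ x → F x ≤ G x
  pointwise x with x ≟ a | x ≟ b
  ... | yes refl | yes refl = ⊥-elim (a≢b refl)
  ... | yes refl | no x≢b =
    subst₂ _≤_ (sym (at-a (f a) (f b) (g b))) (sym (at-a (g a) (g b) (f b))) on
  ... | no x≢a | yes refl =
    subst₂ _≤_ (sym (at-b (f b) (f b) (g b))) (sym (at-b (g b) (g b) (f b))) (≤-reflexive (+-comm (f b) (g b)))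
  ... | no x≢a | no x≢b =
    +-monoˡ-≤ 0 (+-monoˡ-≤ 0 (off x x≢a x≢b))

module _ {A : Set} (P : A → Bool) where

  any⇒∃ : ∀ xs → any P xs ≡ true → ∃[ x ] P x ≡ true
  any⇒∃ (x ∷ xs) h with P x in Px
  ... | true  = x , Px
  ... | false = any⇒∃ xs h

  ∈⇒any : ∀ {x xs} → x ∈ xs → P x ≡ true → any P xs ≡ true
  ∈⇒any (here refl) Px rewrite Px = refl
  ∈⇒any {xs = y ∷ _} (there x∈xs) Px with P y
  ... | true  = refl
  ... | false = ∈⇒any x∈xs Px

  ∀⇒all : ∀ xs → (∀ x → P x ≡ true) → all P xs ≡ true
  ∀⇒all []       _   = refl
  ∀⇒all (x ∷ xs) all-P rewrite all-P x = ∀⇒all xs all-P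

  all⇒∈ : ∀ {x xs} → all P xs ≡ true → x ∈ xs → P x ≡ true
  all⇒∈ {xs = y ∷ _} h x∈xs with P y in Py
  all⇒∈ h (here refl)  | true = Py
  all⇒∈ h (there x∈xs) | true = all⇒∈ h x∈xs

  all-false⇒∃ : ∀ xs → all P xs ≡ false → ∃[ x ] P x ≡ false
  all-false⇒∃ (x ∷ xs) h with P x in Px
  ... | false = x , Px
  ... | true  = all-false⇒∃ xs h

module _ {n : ℕ} (P : Fin n → Bool) where

  anyV⇒∃ : anyV P ≡ true → ∃[ x ] P x ≡ true
  anyV⇒∃ = any⇒∃ P (allFin n)

  ∃⇒anyV : ∀ x → P x ≡ true → anyV P ≡ true
  ∃⇒anyV x = ∈⇒any P (∈-allFin x)

  anyV-false⇒∀ : anyV P ≡ false → ∀ x → P x ≡ false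
  anyV-false⇒∀ h x with P x in Px
  ... | false = refl
  ... | true  with () ← trans (sym (∃⇒anyV x Px)) h

  ∀⇒allV : (∀ x → P x ≡ true) → allV P ≡ true
  ∀⇒allV = ∀⇒all P (allFin n)

  allV⇒∀ : allV P ≡ true → ∀ x → P x ≡ true
  allV⇒∀ h x = all⇒∈ P h (∈-allFin x)

  allV-false⇒∃ : allV P ≡ false → ∃[ x ] P x ≡ false
  allV-false⇒∃ = all-false⇒∃ P (allFin n)

_⊆ᵛ_ : ∀ {n} → VSet n → VSet n → Set
S ⊆ᵛ T = ∀ u → S u ≡ true → T u ≡ true

module _ {n} (G : Graph n) where

  walk-mono : ∀ {S T : VSet n} {u v} → S ⊆ᵛ T → WalkIn G S u v → WalkIn G T u v
  walk-mono S⊆T (stop Sv)        = stop (S⊆T _ Sv)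
  walk-mono S⊆T (step Su uw w⇝v) = step (S⊆T _ Su) uw (walk-mono S⊆T w⇝v)

  walk-++ : ∀ {S : VSet n} {u w v} → WalkIn G S u w → WalkIn G S w v → WalkIn G S u v
  walk-++ (stop _)          w⇝v = w⇝v
  walk-++ (step Su uw′ w′⇝w) w⇝v = step Su uw′ (walk-++ w′⇝w w⇝v)

-- Rooted minors and Mader's theorem

module _ {N} (G : Graph N) where

  -- A minor of G whose vertices are vertices of G, each lying in its own branch set.
  record RootedMinor : Set where
    field
      vertex           : VSet N
      branch           : Fin N → VSet N
      edge             : Fin N → Fin N → Bool
      root∈branch      : ∀ a → vertex a ≡ true → branch a a ≡ true
      branch-disjoint  : ∀ a b u → branch a u ≡ true → branch b u ≡ true → a ≡ b
      branch-connected : ∀ a u v → branch a u ≡ true → branch a v ≡ true → WalkIn G (branch a) u v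
      edge⇒vertex      : ∀ a b → edge a b ≡ true → vertex a ≡ true
      edge-sym         : ∀ a b → edge a b ≡ edge b a
      edge-irrefl      : ∀ a → edge a a ≡ false
      edge-realised    : ∀ a b → edge a b ≡ true →
                         ∃[ u ] ∃[ v ] (branch a u ≡ true × branch b v ≡ true × adj G u v ≡ true)

    order : ℕ
    order = ∑[ x < N ] 𝟙 (vertex x)

    degree : Fin N → ℕ
    degree x = ∑[ y < N ] 𝟙 (edge x y)

    degreeSum : ℕ
    degreeSum = ∑[ x < N ] degree x

    commonNeighbours : Fin N → Fin N → ℕ
    commonNeighbours a b = ∑[ y < N ] 𝟙 (edge a y ∧ edge b y)

  record CliqueMinor (S : RootedMinor) (t : ℕ) : Set where
    open RootedMinor S
    field
      bag           : Fin t → VSet N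
      bag⊇branch    : ∀ i → ∃[ a ] (vertex a ≡ true × branch a ⊆ᵛ bag i)
      bag⊆branches  : ∀ i u → bag i u ≡ true → ∃[ a ] branch a u ≡ true
      bag-disjoint  : ∀ i j u → bag i u ≡ true → bag j u ≡ true → i ≡ j
      bag-connected : ∀ i u v → bag i u ≡ true → bag i v ≡ true → WalkIn G (bag i) u v
      bag-adjacent  : ∀ i j → i ≢ j → ∃[ u ] ∃[ v ] (bag i u ≡ true × bag j v ≡ true × adj G u v ≡ true)

  emptyClique : (S : RootedMinor) → CliqueMinor S 0
  emptyClique S = record
    { bag = λ () ; bag⊇branch = λ () ; bag⊆branches = λ () ; bag-disjoint = λ ()
    ; bag-connected = λ () ; bag-adjacent = λ () }

  cliqueMinor⇒minorModel : ∀ {S t} → CliqueMinor S t → (H : Graph t) → H ≼ G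
  cliqueMinor⇒minorModel {S} K H = record
    { branch    = bag
    ; nonempty  = λ i → let a , va , a⊆ = bag⊇branch i in a , a⊆ a (RootedMinor.root∈branch S a va)
    ; disjoint  = disjoint
    ; connected = bag-connected
    ; edges     = λ i j ij → bag-adjacent i j (λ { refl → true≢false (trans (sym ij) (irrefl H i)) }) }
    where
    open CliqueMinor K
    disjoint : ∀ i j u → i ≢ j → bag i u ≡ true → bag j u ≡ false
    disjoint i j u i≢j iu with bag j u in ju
    ... | true  = ⊥-elim (i≢j (bag-disjoint i j u iu ju))
    ... | false = refl

  -- Contracting the edge ab: b is removed, and its branch set and edges are merged into those of a.
  module Contraction (S : RootedMinor) {a b : Fin N} (ab : RootedMinor.edge S a b ≡ true) where
    open RootedMinor S

    a≢b : a ≢ b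
    a≢b refl = true≢false (trans (sym ab) (edge-irrefl a))

    va : vertex a ≡ true
    va = edge⇒vertex a b ab

    vb : vertex b ≡ true
    vb = edge⇒vertex b a (trans (edge-sym b a) ab)

    vertex/ : VSet N
    vertex/ x = vertex x ∧ not (x == b)

    branch/ : Fin N → VSet N
    branch/ x u = if x == a then branch a u ∨ branch b u else not (x == b) ∧ branch x u

    edge/ : Fin N → Fin N → Bool
    edge/ x y = not (x == b) ∧ (not (y == b) ∧ (not (x == y) ∧
                (edge x y ∨ ((x == a ∧ edge b y) ∨ (y == a ∧ edge x b)))))

    branch⊆branch/ : ∀ {x} → x ≢ b → branch x ⊆ᵛ branch/ x
    branch⊆branch/ {x} x≢b u xu with x ≟ a
    ... | yes refl rewrite xu = refl
    ... | no  _    rewrite ≢⇒==-false x≢b | xu = refl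

    branch-a⊆branch/-a : branch a ⊆ᵛ branch/ a
    branch-a⊆branch/-a = branch⊆branch/ a≢b

    branch-b⊆branch/-a : branch b ⊆ᵛ branch/ a
    branch-b⊆branch/-a u bu rewrite ==-refl a | bu = Boolₚ.∨-zeroʳ (branch a u)

    branch/-cases : ∀ x u → branch/ x u ≡ true →
      (x ≡ a × (branch a u ≡ true ⊎ branch b u ≡ true)) ⊎ (x ≢ a × x ≢ b × branch x u ≡ true)
    branch/-cases x u xu with x ≟ a
    ... | yes x≡a = inj₁ (x≡a , ∨-true⇒ xu)
    ... | no  x≢a = let x≢b , bxu = ∧-true⇒ xu in inj₂ (x≢a , not-==⇒≢ x≢b , bxu)

    branch/-disjoint : ∀ x y u → branch/ x u ≡ true → branch/ y u ≡ true → x ≡ y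
    branch/-disjoint x y u xu yu with branch/-cases x u xu | branch/-cases y u yu
    ... | inj₁ (refl , _)           | inj₁ (refl , _)           = refl
    ... | inj₁ (refl , inj₁ au)     | inj₂ (y≢a , _ , yu′)      = ⊥-elim (y≢a (sym (branch-disjoint a y u au yu′)))
    ... | inj₁ (refl , inj₂ bu)     | inj₂ (_ , y≢b , yu′)      = ⊥-elim (y≢b (sym (branch-disjoint b y u bu yu′)))
    ... | inj₂ (x≢a , _ , xu′)      | inj₁ (refl , inj₁ au)     = ⊥-elim (x≢a (branch-disjoint x a u xu′ au))
    ... | inj₂ (_ , x≢b , xu′)      | inj₁ (refl , inj₂ bu)     = ⊥-elim (x≢b (branch-disjoint x b u xu′ bu))
    ... | inj₂ (_ , _ , xu′)        | inj₂ (_ , _ , yu′)        = branch-disjoint x y u xu′ yu′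

    private
      realised-ab = edge-realised a b ab
      u₀ = proj₁ realised-ab
      v₀ = proj₁ (proj₂ realised-ab)
      au₀ : branch a u₀ ≡ true
      au₀ = proj₁ (proj₂ (proj₂ realised-ab))
      bv₀ : branch b v₀ ≡ true
      bv₀ = proj₁ (proj₂ (proj₂ (proj₂ realised-ab)))
      u₀v₀ : adj G u₀ v₀ ≡ true
      u₀v₀ = proj₂ (proj₂ (proj₂ (proj₂ realised-ab)))

    walk-to-u₀ : ∀ u → branch a u ≡ true ⊎ branch b u ≡ true → WalkIn G (branch/ a) u u₀
    walk-to-u₀ u (inj₁ au) = walk-mono G branch-a⊆branch/-a (branch-connected a u u₀ au au₀)
    walk-to-u₀ u (inj₂ bu) =
      walk-++ G (walk-mono G branch-b⊆branch/-a (branch-connected b u v₀ bu bv₀))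
                (step (branch-b⊆branch/-a v₀ bv₀) (trans (Graph.sym G v₀ u₀) u₀v₀)
                      (stop (branch-a⊆branch/-a u₀ au₀)))

    walk-from-u₀ : ∀ v → branch a v ≡ true ⊎ branch b v ≡ true → WalkIn G (branch/ a) u₀ v
    walk-from-u₀ v (inj₁ av) = walk-mono G branch-a⊆branch/-a (branch-connected a u₀ v au₀ av)
    walk-from-u₀ v (inj₂ bv) =
      step (branch-a⊆branch/-a u₀ au₀) u₀v₀ (walk-mono G branch-b⊆branch/-a (branch-connected b v₀ v bv₀ bv))

    branch/-connected : ∀ x u v → branch/ x u ≡ true → branch/ x v ≡ true → WalkIn G (branch/ x) u v
    branch/-connected x u v xu xv with branch/-cases x u xu | branch/-cases x v xv
    ... | inj₁ (refl , u∈) | inj₁ (_ , v∈)   = walk-++ G (walk-to-u₀ u u∈) (walk-from-u₀ v v∈)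
    ... | inj₁ (refl , _)  | inj₂ (x≢a , _)  = ⊥-elim (x≢a refl)
    ... | inj₂ (x≢a , _)   | inj₁ (refl , _) = ⊥-elim (x≢a refl)
    ... | inj₂ (_ , x≢b , xu′) | inj₂ (_ , _ , xv′) =
      walk-mono G (branch⊆branch/ x≢b) (branch-connected x u v xu′ xv′)

    edge/-cases : ∀ x y → edge/ x y ≡ true →
      x ≢ b × y ≢ b × (edge x y ≡ true ⊎ (x ≡ a × edge b y ≡ true) ⊎ (y ≡ a × edge x b ≡ true))
    edge/-cases x y xy =
      let nxb , xy₁ = ∧-true⇒ xy
          nyb , xy₂ = ∧-true⇒ xy₁
          _   , xy₃ = ∧-true⇒ xy₂
      in not-==⇒≢ nxb , not-==⇒≢ nyb , cases (∨-true⇒ xy₃)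
      where
      cases : edge x y ≡ true ⊎ (x == a ∧ edge b y) ∨ (y == a ∧ edge x b) ≡ true →
              edge x y ≡ true ⊎ (x ≡ a × edge b y ≡ true) ⊎ (y ≡ a × edge x b ≡ true)
      cases (inj₁ e) = inj₁ e
      cases (inj₂ e) with ∨-true⇒ e
      ... | inj₁ e′ = let xa , by = ∧-true⇒ e′ in inj₂ (inj₁ (==⇒≡ xa , by))
      ... | inj₂ e′ = let ya , xb = ∧-true⇒ e′ in inj₂ (inj₂ (==⇒≡ ya , xb))

    edge/⇒vertex/ : ∀ x y → edge/ x y ≡ true → vertex/ x ≡ true
    edge/⇒vertex/ x y xy with edge/-cases x y xy
    ... | x≢b , _ , e rewrite ≢⇒==-false x≢b = trans (Boolₚ.∧-identityʳ (vertex x)) (vx e)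
      where
      vx : _ → vertex x ≡ true
      vx (inj₁ xy′)              = edge⇒vertex x y xy′
      vx (inj₂ (inj₁ (refl , _))) = va
      vx (inj₂ (inj₂ (_ , xb)))   = edge⇒vertex x b xb

    edge/-sym : ∀ x y → edge/ x y ≡ edge/ y x
    edge/-sym x y rewrite ==-sym y x | edge-sym y x | edge-sym b x | edge-sym y b =
      swap (not (x == b)) (not (y == b)) (not (x == y)) (edge x y) (x == a ∧ edge b y) (y == a ∧ edge x b)
      where
      swap : ∀ p q r e s t → p ∧ (q ∧ (r ∧ (e ∨ (s ∨ t)))) ≡ q ∧ (p ∧ (r ∧ (e ∨ (t ∨ s))))
      swap true  true  r e s t = cong (λ z → r ∧ (e ∨ z)) (Boolₚ.∨-comm s t)
      swap true  false r e s t = refl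
      swap false true  r e s t = refl
      swap false false r e s t = refl

    edge/-irrefl : ∀ x → edge/ x x ≡ false
    edge/-irrefl x rewrite ==-refl x with not (x == b)
    ... | true  = refl
    ... | false = refl

    edge/-realised : ∀ x y → edge/ x y ≡ true →
                     ∃[ u ] ∃[ v ] (branch/ x u ≡ true × branch/ y v ≡ true × adj G u v ≡ true)
    edge/-realised x y xy with edge/-cases x y xy
    ... | x≢b , y≢b , inj₁ xy′ =
      let u , v , xu , yv , uv = edge-realised x y xy′
      in u , v , branch⊆branch/ x≢b u xu , branch⊆branch/ y≢b v yv , uv
    ... | _ , y≢b , inj₂ (inj₁ (refl , by)) =
      let u , v , bu , yv , uv = edge-realised b y by
      in u , v , branch-b⊆branch/-a u bu , branch⊆branch/ y≢b v yv , uv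
    ... | x≢b , _ , inj₂ (inj₂ (refl , xb)) =
      let u , v , xu , bv , uv = edge-realised x b xb
      in u , v , branch⊆branch/ x≢b u xu , branch-b⊆branch/-a v bv , uv

    branch/-root : ∀ x → vertex/ x ≡ true → branch/ x x ≡ true
    branch/-root x vx/ with ∧-true⇒ {vertex x} vx/
    ... | vx , nxb = branch⊆branch/ (not-==⇒≢ nxb) x (root∈branch x vx)

    contracted : RootedMinor
    contracted = record
      { vertex = vertex/ ; branch = branch/ ; edge = edge/
      ; root∈branch = branch/-root ; branch-disjoint = branch/-disjoint ; branch-connected = branch/-connected
      ; edge⇒vertex = edge/⇒vertex/ ; edge-sym = edge/-sym ; edge-irrefl = edge/-irrefl
      ; edge-realised = edge/-realised }

    lift : ∀ {t} → CliqueMinor contracted t → CliqueMinor S t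
    lift K = record
      { bag           = bag
      ; bag⊇branch    = λ i → let x , vx/ , x⊆ = bag⊇branch i
                                  vx , nxb = ∧-true⇒ {vertex x} vx/
                              in x , vx , λ u xu → x⊆ u (branch⊆branch/ (not-==⇒≢ nxb) u xu)
      ; bag⊆branches  = λ i u iu → let x , xu = bag⊆branches i u iu in unmerge x u xu
      ; bag-disjoint  = bag-disjoint
      ; bag-connected = bag-connected
      ; bag-adjacent  = bag-adjacent }
      where
      open CliqueMinor K
      unmerge : ∀ x u → branch/ x u ≡ true → ∃[ y ] branch y u ≡ true
      unmerge x u xu with branch/-cases x u xu
      ... | inj₁ (_ , inj₁ au)     = a , au
      ... | inj₁ (_ , inj₂ bu)     = b , bu
      ... | inj₂ (_ , _ , xu′)     = x , xu′

    private
      module S/ = RootedMinor contracted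

    order-contracted : order ≡ suc S/.order
    order-contracted = begin
      order                                                     ≡⟨ sum-cong-≗ split ⟩
      ∑[ x < N ] (𝟙 (vertex/ x) + 𝟙 (x == b))                   ≡⟨ ∑-distrib-+ (𝟙 ∘ vertex/) _ ⟩
      S/.order + ∑[ x < N ] 𝟙 (x == b)                          ≡⟨ cong (S/.order +_) (∑-δ₁ b) ⟩
      S/.order + 1                                              ≡⟨ +-comm S/.order 1 ⟩
      suc S/.order                                              ∎
      where
      open ≡-Reasoning
      split : ∀ x → 𝟙 (vertex x) ≡ 𝟙 (vertex/ x) + 𝟙 (x == b)
      split x with x ≟ b
      ... | yes refl rewrite vb = refl
      ... | no  _    rewrite Boolₚ.∧-identityʳ (vertex x) = sym (+-identityʳ _)

    order-contracted-pos : 0 < S/.order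
    order-contracted-pos = subst (_≤ S/.order) a∈ (≤∑ (𝟙 ∘ vertex/) a)
      where
      a∈ : 𝟙 (vertex/ a) ≡ 1
      a∈ rewrite va | ≢⇒==-false a≢b = refl

    edge/-off : ∀ {x y} → x ≢ a → x ≢ b → y ≢ a → y ≢ b → edge/ x y ≡ edge x y
    edge/-off {x} {y} x≢a x≢b y≢a y≢b
      rewrite ≢⇒==-false x≢a | ≢⇒==-false x≢b | ≢⇒==-false y≢a | ≢⇒==-false y≢b with x ≟ y
    ... | yes refl = sym (edge-irrefl x)
    ... | no  _    = Boolₚ.∨-identityʳ (edge x y)

    edge/-to-b : ∀ x → edge/ x b ≡ false
    edge/-to-b x rewrite ==-refl b = Boolₚ.∧-zeroʳ (not (x == b))

    edge/-to-a : ∀ {x} → x ≢ a → x ≢ b → edge/ x a ≡ edge x a ∨ edge x b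
    edge/-to-a x≢a x≢b rewrite ≢⇒==-false x≢a | ≢⇒==-false x≢b | ≢⇒==-false a≢b | ==-refl a = refl

    edge/-from-a : ∀ {y} → y ≢ a → y ≢ b → edge/ a y ≡ edge a y ∨ edge b y
    edge/-from-a {y} y≢a y≢b
      rewrite ==-refl a | ≢⇒==-false a≢b | ≢⇒==-false y≢a | ≢⇒==-false y≢b | ≢⇒==-false (y≢a ∘ sym) =
      cong (edge a y ∨_) (Boolₚ.∨-identityʳ (edge b y))

    degree-off-pair : ∀ {x} → x ≢ a → x ≢ b → degree x ≤ S/.degree x + 𝟙 (edge x a ∧ edge x b)
    degree-off-pair {x} x≢a x≢b = subst (degree x ≤_) ∑g (∑-mono-≤-off-pair a b a≢b off on)
      where
      g : Fin N → ℕ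
      g y = 𝟙 (edge/ x y) + 𝟙 (y == a) * 𝟙 (edge x a ∧ edge x b)
      ∑g : sum g ≡ S/.degree x + 𝟙 (edge x a ∧ edge x b)
      ∑g = trans (∑-distrib-+ (𝟙 ∘ edge/ x) _) (cong (S/.degree x +_) (∑-δ a _))
      off : ∀ y → y ≢ a → y ≢ b → 𝟙 (edge x y) ≤ g y
      off y y≢a y≢b rewrite edge/-off x≢a x≢b y≢a y≢b | ≢⇒==-false y≢a = m≤m+n _ _
      on : 𝟙 (edge x a) + 𝟙 (edge x b) ≤ g a + g b
      on rewrite edge/-to-a x≢a x≢b | edge/-to-b x | ==-refl a | ≢⇒==-false (a≢b ∘ sym) =
        ≤-reflexive (trans (𝟙-∨+𝟙-∧ (edge x a) (edge x b))
                           (trans (cong (𝟙 (edge x a ∨ edge x b) +_) (sym (*-identityˡ _))) (sym (+-identityʳ _))))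

    degree-pair : degree a + degree b ≤ S/.degree a + commonNeighbours a b + 4
    degree-pair = subst₂ _≤_ (∑-distrib-+ (λ y → 𝟙 (edge a y)) _) ∑g (∑-mono-≤-off-pair a b a≢b off on)
      where
      g : Fin N → ℕ
      g y = 𝟙 (edge/ a y) + 𝟙 (edge a y ∧ edge b y) + 𝟙 (y == a) * 4
      ∑g : sum g ≡ S/.degree a + commonNeighbours a b + 4
      ∑g = trans (∑-distrib-+ (λ y → 𝟙 (edge/ a y) + 𝟙 (edge a y ∧ edge b y)) _)
                 (cong₂ _+_ (∑-distrib-+ (𝟙 ∘ edge/ a) _) (∑-δ a 4))
      off : ∀ y → y ≢ a → y ≢ b → 𝟙 (edge a y) + 𝟙 (edge b y) ≤ g y
      off y y≢a y≢b = ≤-trans (≤-reflexive merged) (m≤m+n _ _)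
        where
        merged : 𝟙 (edge a y) + 𝟙 (edge b y) ≡ 𝟙 (edge/ a y) + 𝟙 (edge a y ∧ edge b y)
        merged = trans (𝟙-∨+𝟙-∧ (edge a y) (edge b y))
                       (cong (λ e → 𝟙 e + 𝟙 (edge a y ∧ edge b y)) (sym (edge/-from-a y≢a y≢b)))
      on : (𝟙 (edge a a) + 𝟙 (edge b a)) + (𝟙 (edge a b) + 𝟙 (edge b b)) ≤ g a + g b
      on = ≤-trans (+-mono-≤ (𝟙+𝟙≤2 (edge a a) (edge b a)) (𝟙+𝟙≤2 (edge a b) (edge b b)))
                   (≤-trans (subst (λ e → 4 ≤ rest + 𝟙 e * 4) (sym (==-refl a)) (m≤n+m 4 rest))
                            (m≤m+n (g a) (g b)))
        where
        rest = 𝟙 (edge/ a a) + 𝟙 (edge a a ∧ edge b a)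

    degreeSum-contracted : degreeSum ≤ S/.degreeSum + 2 * (2 + commonNeighbours a b)
    degreeSum-contracted = subst (degreeSum ≤_) ∑g (∑-mono-≤-off-pair a b a≢b off on)
      where
      c = commonNeighbours a b
      g : Fin N → ℕ
      g x = S/.degree x + 𝟙 (edge x a ∧ edge x b) + 𝟙 (x == a) * (c + 4)
      common-sym : ∑[ x < N ] 𝟙 (edge x a ∧ edge x b) ≡ c
      common-sym = sum-cong-≗ (λ x → cong₂ (λ p q → 𝟙 (p ∧ q)) (edge-sym x a) (edge-sym x b))
      ∑g : sum g ≡ S/.degreeSum + 2 * (2 + c)
      ∑g = begin
        sum g                                    ≡⟨ ∑-distrib-+ (λ x → S/.degree x + 𝟙 (edge x a ∧ edge x b)) _ ⟩
        _ + ∑[ x < N ] (𝟙 (x == a) * (c + 4))    ≡⟨ cong₂ _+_ (∑-distrib-+ S/.degree _) (∑-δ a (c + 4)) ⟩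
        S/.degreeSum + _ + (c + 4)               ≡⟨ cong (λ z → S/.degreeSum + z + (c + 4)) common-sym ⟩
        S/.degreeSum + c + (c + 4)
          ≡⟨ solve 2 (λ s c → s :+ c :+ (c :+ con 4) := s :+ con 2 :* (con 2 :+ c)) refl S/.degreeSum c ⟩
        S/.degreeSum + 2 * (2 + c)               ∎
        where
        open ≡-Reasoning
        open +-*-Solver using (solve; _:+_; _:*_; _:=_; con)
      off : ∀ x → x ≢ a → x ≢ b → degree x ≤ g x
      off x x≢a x≢b = ≤-trans (degree-off-pair x≢a x≢b) (m≤m+n _ _)
      g-a : S/.degree a + c + 4 ≡ g a
      g-a = sym (begin
        S/.degree a + 𝟙 (edge a a ∧ edge a b) + 𝟙 (a == a) * (c + 4)
          ≡⟨ cong₂ (λ e f → S/.degree a + 𝟙 (e ∧ edge a b) + 𝟙 f * (c + 4)) (edge-irrefl a) (==-refl a) ⟩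
        S/.degree a + 0 + 1 * (c + 4)
          ≡⟨ cong₂ _+_ (+-identityʳ (S/.degree a)) (*-identityˡ (c + 4)) ⟩
        S/.degree a + (c + 4)
          ≡⟨ sym (+-assoc (S/.degree a) c 4) ⟩
        S/.degree a + c + 4 ∎)
        where open ≡-Reasoning
      on : degree a + degree b ≤ g a + g b
      on = ≤-trans degree-pair (≤-trans (≤-reflexive g-a) (m≤m+n (g a) (g b)))

    contracted-dense : ∀ {K} → 2 * (2 + commonNeighbours a b) ≤ K →
                       K * order ≤ degreeSum → K * S/.order ≤ S/.degreeSum
    contracted-dense {K} few-lost dense = +-cancelˡ-≤ K _ _ (begin
      K + K * S/.order                           ≡⟨ sym (*-suc K S/.order) ⟩
      K * suc S/.order                           ≡⟨ cong (K *_) (sym order-contracted) ⟩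
      K * order                                  ≤⟨ dense ⟩
      degreeSum                                  ≤⟨ degreeSum-contracted ⟩
      S/.degreeSum + 2 * (2 + commonNeighbours a b) ≤⟨ +-monoʳ-≤ S/.degreeSum few-lost ⟩
      S/.degreeSum + K                           ≡⟨ +-comm S/.degreeSum K ⟩
      K + S/.degreeSum                           ∎)
      where open ≤-Reasoning

  module Neighbourhood (S : RootedMinor) (v : Fin N) where
    open RootedMinor S

    restricted : RootedMinor
    restricted = record
      { vertex           = edge v
      ; branch           = λ x u → edge v x ∧ branch x u
      ; edge             = λ x y → edge v x ∧ (edge v y ∧ edge x y)
      ; root∈branch      = λ x vx → restrict vx (root∈branch x (neighbour⇒vertex vx))
      ; branch-disjoint  = λ x y u xu yu → branch-disjoint x y u (proj₂ (∧-true⇒ xu)) (proj₂ (∧-true⇒ yu))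
      ; branch-connected = λ x u w xu xw → let vx , xu′ = ∧-true⇒ xu in
          walk-mono G (λ z → restrict vx) (branch-connected x u w xu′ (proj₂ (∧-true⇒ xw)))
      ; edge⇒vertex      = λ x y xy → proj₁ (∧-true⇒ xy)
      ; edge-sym         = λ x y → trans (cong (λ e → edge v x ∧ (edge v y ∧ e)) (edge-sym x y))
                                         (∧-swap (edge v x) (edge v y) (edge y x))
      ; edge-irrefl      = restricted-irrefl
      ; edge-realised    = realised
      }
      where
      restrict : ∀ {x u} → edge v x ≡ true → branch x u ≡ true → edge v x ∧ branch x u ≡ true
      restrict vx xu rewrite vx = xu
      neighbour⇒vertex : ∀ {x} → edge v x ≡ true → vertex x ≡ true
      neighbour⇒vertex {x} vx = edge⇒vertex x v (trans (edge-sym x v) vx)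
      ∧-swap : ∀ p q r → p ∧ (q ∧ r) ≡ q ∧ (p ∧ r)
      ∧-swap true  q     r = refl
      ∧-swap false true  r = refl
      ∧-swap false false r = refl
      realised : ∀ x y → edge v x ∧ (edge v y ∧ edge x y) ≡ true →
                 ∃[ u ] ∃[ w ] (edge v x ∧ branch x u ≡ true × edge v y ∧ branch y w ≡ true × adj G u w ≡ true)
      realised x y xy with ∧-true⇒ xy
      ... | vx , xy₁ with ∧-true⇒ xy₁
      ... | vy , xy₂ with edge-realised x y xy₂
      ... | u , w , xu , yw , uw = u , w , restrict vx xu , restrict vy yw , uw
      restricted-irrefl : ∀ x → edge v x ∧ (edge v x ∧ edge x x) ≡ false
      restricted-irrefl x rewrite edge-irrefl x with edge v x
      ... | true  = refl
      ... | false = refl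

    private
      module Sᵥ = RootedMinor restricted

    degree-restricted : ∀ {x} → edge v x ≡ true → Sᵥ.degree x ≡ commonNeighbours v x
    degree-restricted {x} vx = sum-cong-≗ (λ y → cong (λ e → 𝟙 (e ∧ (edge v y ∧ edge x y))) vx)

    -- v is adjacent to every bag of a clique minor in its neighbourhood, so its branch set extends it.
    extend : ∀ {t} → vertex v ≡ true → CliqueMinor restricted t → CliqueMinor S (suc t)
    extend {t} vv K = record
      { bag = bag′ ; bag⊇branch = bag′⊇branch ; bag⊆branches = bag′⊆branches
      ; bag-disjoint = bag′-disjoint ; bag-connected = bag′-connected ; bag-adjacent = bag′-adjacent }
      where
      open CliqueMinor K
      bag′ : Fin (suc t) → VSet N
      bag′ Fin.zero    = branch v
      bag′ (Fin.suc i) = bag i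
      bag′⊇branch : ∀ i → ∃[ x ] (vertex x ≡ true × branch x ⊆ᵛ bag′ i)
      bag′⊇branch Fin.zero    = v , vv , λ _ vu → vu
      bag′⊇branch (Fin.suc i) with bag⊇branch i
      ... | x , vx , x⊆ =
        x , edge⇒vertex x v (trans (edge-sym x v) vx) ,
        λ u xu → x⊆ u (subst (λ e → e ∧ branch x u ≡ true) (sym vx) xu)
      bag′⊆branches : ∀ i u → bag′ i u ≡ true → ∃[ x ] branch x u ≡ true
      bag′⊆branches Fin.zero    u vu = v , vu
      bag′⊆branches (Fin.suc i) u iu with bag⊆branches i u iu
      ... | x , xu = x , proj₂ (∧-true⇒ xu)
      branch-v∉bag : ∀ j u → branch v u ≡ true → bag j u ≡ false
      branch-v∉bag j u vu with bag j u in ju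
      ... | false = refl
      ... | true with bag⊆branches j u ju
      ... | x , xu with ∧-true⇒ xu
      ... | vx , xu′ with branch-disjoint v x u vu xu′
      ... | refl = ⊥-elim (true≢false (trans (sym vx) (edge-irrefl v)))
      bag′-disjoint : ∀ i j u → bag′ i u ≡ true → bag′ j u ≡ true → i ≡ j
      bag′-disjoint Fin.zero    Fin.zero    u _  _  = refl
      bag′-disjoint Fin.zero    (Fin.suc j) u vu ju = ⊥-elim (true≢false (trans (sym ju) (branch-v∉bag j u vu)))
      bag′-disjoint (Fin.suc i) Fin.zero    u iu vu = ⊥-elim (true≢false (trans (sym iu) (branch-v∉bag i u vu)))
      bag′-disjoint (Fin.suc i) (Fin.suc j) u iu ju = cong Fin.suc (bag-disjoint i j u iu ju)
      bag′-connected : ∀ i u w → bag′ i u ≡ true → bag′ i w ≡ true → WalkIn G (bag′ i) u w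
      bag′-connected Fin.zero    = branch-connected v
      bag′-connected (Fin.suc i) = bag-connected i
      branch-v-adjacent : ∀ j → ∃[ u ] ∃[ w ] (branch v u ≡ true × bag j w ≡ true × adj G u w ≡ true)
      branch-v-adjacent j with bag⊇branch j
      ... | x , vx , x⊆ with edge-realised v x vx
      ... | u , w , vu , xw , uw = u , w , vu , x⊆ w (subst (λ e → e ∧ branch x w ≡ true) (sym vx) xw) , uw
      bag′-adjacent : ∀ i j → i ≢ j → ∃[ u ] ∃[ w ] (bag′ i u ≡ true × bag′ j w ≡ true × adj G u w ≡ true)
      bag′-adjacent Fin.zero    Fin.zero    0≢0 = ⊥-elim (0≢0 refl)
      bag′-adjacent Fin.zero    (Fin.suc j) _   = branch-v-adjacent j
      bag′-adjacent (Fin.suc i) Fin.zero    _   with branch-v-adjacent i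
      ... | u , w , vu , iw , uw = w , u , iw , vu , trans (Graph.sym G w u) uw
      bag′-adjacent (Fin.suc i) (Fin.suc j) i≢j = bag-adjacent i j (i≢j ∘ cong Fin.suc)

cliqueDensity : ℕ → ℕ
cliqueDensity zero    = 1
cliqueDensity (suc t) = 2 * suc (cliqueDensity t)

cliqueDensity-pos : ∀ t → 0 < cliqueDensity t
cliqueDensity-pos zero    = s≤s z≤n
cliqueDensity-pos (suc t) = s≤s z≤n

dense⇒degreeSum-pos : ∀ {K order degreeSum} → 0 < K → 0 < order → K * order ≤ degreeSum → 0 < degreeSum
dense⇒degreeSum-pos K>0 order>0 dense = ≤-trans (*-mono-≤ K>0 order>0) dense

module _ {N} {G : Graph N} where
  open RootedMinor

  SparseEdge : RootedMinor G → ℕ → Set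
  SparseEdge S k = ∃[ a ] ∃[ b ] (edge S a b ≡ true × commonNeighbours S a b < k)

  sparseEdge? : ∀ S k → Dec (SparseEdge S k)
  sparseEdge? S k = Finₚ.any? λ a → Finₚ.any? λ b → (edge S a b Boolₚ.≟ true) ×-dec (commonNeighbours S a b <? k)

  -- Mader's induction step: contract an edge with few common neighbours if there is one (this
  -- keeps the density); otherwise the neighbourhood of any vertex is dense enough to contain K_t.
  cliqueMinor-step : ∀ t (S : RootedMinor G) →
    (∀ S′ → order S′ < order S → 0 < degreeSum S′ → cliqueDensity (suc t) * order S′ ≤ degreeSum S′ →
       CliqueMinor G S′ (suc t)) →
    (∀ S′ → 0 < degreeSum S′ → cliqueDensity t * order S′ ≤ degreeSum S′ → CliqueMinor G S′ t) →
    0 < degreeSum S → cliqueDensity (suc t) * order S ≤ degreeSum S → CliqueMinor G S (suc t)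
  cliqueMinor-step t S smaller-minor sparser-minor pos dense with sparseEdge? S (cliqueDensity t)
  ... | yes (a , b , ab , sparse) =
    lift (smaller-minor contracted (≤-reflexive (sym order-contracted)) pos′ dense′)
    where
    open Contraction G S ab
    dense′ : cliqueDensity (suc t) * order contracted ≤ degreeSum contracted
    dense′ = contracted-dense (*-monoʳ-≤ 2 (s≤s sparse)) dense
    pos′ : 0 < degreeSum contracted
    pos′ = dense⇒degreeSum-pos (cliqueDensity-pos (suc t)) order-contracted-pos dense′
  ... | no no-sparse with ∑-pos⇒∃-pos (degree S) pos
  ... | v , deg-v>0 with ∑-pos⇒∃-pos (λ y → 𝟙 (edge S v y)) deg-v>0
  ... | u , vu>0 = extend (edge⇒vertex S v u vu) (sparser-minor restricted pos′ dense′)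
    where
    open Neighbourhood G S v
    vu : edge S v u ≡ true
    vu = 𝟙-pos vu>0
    dense-at : ∀ x → cliqueDensity t * 𝟙 (edge S v x) ≤ degree restricted x
    dense-at x = by-edge (edge S v x) refl
      where
      by-edge : ∀ e → edge S v x ≡ e → cliqueDensity t * 𝟙 e ≤ degree restricted x
      by-edge false _  = ≤-trans (≤-reflexive (*-zeroʳ (cliqueDensity t))) z≤n
      by-edge true  vx = subst₂ _≤_ (sym (*-identityʳ _)) (sym (degree-restricted vx))
                                (≮⇒≥ λ sparse → no-sparse (v , x , vx , sparse))
    dense′ : cliqueDensity t * order restricted ≤ degreeSum restricted
    dense′ = subst (_≤ degreeSum restricted) (∑-*ˡ (cliqueDensity t) (λ x → 𝟙 (edge S v x))) (∑-mono-≤ dense-at)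
    pos′ : 0 < degreeSum restricted
    pos′ = dense⇒degreeSum-pos (cliqueDensity-pos t) (subst (_≤ order restricted) (𝟙-true vu) (≤∑ _ u)) dense′

  cliqueMinor : ∀ t (S : RootedMinor G) → Acc _<_ (order S) → 0 < degreeSum S →
                cliqueDensity t * order S ≤ degreeSum S → CliqueMinor G S t
  cliqueMinor zero    S _         _ _ = emptyClique G S
  cliqueMinor (suc t) S (acc rec)     =
    cliqueMinor-step t S (λ S′ lt → cliqueMinor (suc t) S′ (rec lt)) (λ S′ → cliqueMinor t S′ (<-wellFounded _))

  degreeSum-bounded : ∀ {m} (H : Graph m) → ¬ (H ≼ G) → (S : RootedMinor G) →
                      degreeSum S ≤ cliqueDensity m * order S
  degreeSum-bounded {m} H H⋠G S with degreeSum S in eq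
  ... | zero = z≤n
  ... | suc d with cliqueDensity m * order S ≤? suc d
  ... | no  ¬dense = <⇒≤ (≰⇒> ¬dense)
  ... | yes dense  = ⊥-elim (H⋠G (cliqueMinor⇒minorModel G K H))
    where
    K : CliqueMinor G S m
    K = cliqueMinor m S (<-wellFounded _) (subst (0 <_) (sym eq) (s≤s z≤n))
                    (subst (cliqueDensity m * order S ≤_) (sym eq) dense)

-- The vertices of W outside A are contracted into A along the injective map p.
module ContractionOnto {N} (G : Graph N) (A W : VSet N) (p : Fin N → Fin N)
  (p∈A : ∀ w → W w ≡ true → A (p w) ≡ true)
  (w∈Γ⁺p : ∀ w → W w ≡ true → Γ⁺ G (p w) w ≡ true)
  (p-injective : ∀ w w′ → W w ≡ true → W w′ ≡ true → p w ≡ p w′ → w ≡ w′) where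

  branch : Fin N → VSet N
  branch a u = A a ∧ (u == a ∨ (W u ∧ (not (A u) ∧ p u == a)))

  linked : Fin N → Fin N → Bool
  linked a b = anyV λ u → anyV λ v → branch a u ∧ (branch b v ∧ adj G u v)

  edge : Fin N → Fin N → Bool
  edge a b = A a ∧ (A b ∧ (not (a == b) ∧ (linked a b ∨ linked b a)))

  branch-cases : ∀ a u → branch a u ≡ true → A a ≡ true × (u ≡ a ⊎ (W u ≡ true × A u ≡ false × p u ≡ a))
  branch-cases a u au with ∧-true⇒ au
  ... | Aa , au′ with ∨-true⇒ au′
  ... | inj₁ u≡a = Aa , inj₁ (==⇒≡ u≡a)
  ... | inj₂ Wu… with ∧-true⇒ Wu…
  ... | Wu , u… with ∧-true⇒ u…
  ... | ¬Au , pu≡a = Aa , inj₂ (Wu , not-true⇒ ¬Au , ==⇒≡ pu≡a)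

  root∈branch : ∀ a → A a ≡ true → branch a a ≡ true
  root∈branch a Aa rewrite Aa | ==-refl a = refl

  contracted∈branch : ∀ w → W w ≡ true → A w ≡ false → branch (p w) w ≡ true
  contracted∈branch w Ww ¬Aw rewrite p∈A w Ww | Ww | ¬Aw | ==-refl (p w) = Boolₚ.∨-zeroʳ (w == p w)

  branch-disjoint : ∀ a b u → branch a u ≡ true → branch b u ≡ true → a ≡ b
  branch-disjoint a b u au bu with branch-cases a u au | branch-cases b u bu
  ... | _  , inj₁ refl                | _  , inj₁ refl                = refl
  ... | Aa , inj₁ refl                | _  , inj₂ (_ , ¬Aa , _)       = ⊥-elim (true≢false (trans (sym Aa) ¬Aa))
  ... | _  , inj₂ (_ , ¬Ab , _)       | Ab , inj₁ refl                = ⊥-elim (true≢false (trans (sym Ab) ¬Ab))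
  ... | _  , inj₂ (_ , _ , pu≡a)      | _  , inj₂ (_ , _ , pu≡b)      = trans (sym pu≡a) pu≡b

  contracted-adjacent : ∀ u → W u ≡ true → A u ≡ false → adj G u (p u) ≡ true
  contracted-adjacent u Wu ¬Au with ∨-true⇒ (w∈Γ⁺p u Wu)
  ... | inj₂ pu-u = trans (Graph.sym G u (p u)) pu-u
  ... | inj₁ pu≡u = ⊥-elim (true≢false (trans (sym (p∈A u Wu)) (subst (λ x → A x ≡ false) (sym (==⇒≡ pu≡u)) ¬Au)))

  branch-connected : ∀ a u v → branch a u ≡ true → branch a v ≡ true → WalkIn G (branch a) u v
  branch-connected a u v au av = walk-++ G (to-root u au) (from-root v av)
    where
    to-root : ∀ u → branch a u ≡ true → WalkIn G (branch a) u a
    to-root u au with branch-cases a u au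
    ... | _  , inj₁ refl                = stop au
    ... | Aa , inj₂ (Wu , ¬Au , refl) = step au (contracted-adjacent u Wu ¬Au) (stop (root∈branch a Aa))
    from-root : ∀ v → branch a v ≡ true → WalkIn G (branch a) a v
    from-root v av with branch-cases a v av
    ... | _  , inj₁ refl                = stop av
    ... | Aa , inj₂ (Wv , ¬Av , refl) =
      step (root∈branch a Aa) (trans (Graph.sym G a v) (contracted-adjacent v Wv ¬Av)) (stop av)

  edge-sym : ∀ a b → edge a b ≡ edge b a
  edge-sym a b rewrite ==-sym a b | Boolₚ.∨-comm (linked a b) (linked b a) with A a | A b
  ... | true  | true  = refl
  ... | true  | false = refl
  ... | false | true  = refl
  ... | false | false = refl

  edge-irrefl : ∀ a → edge a a ≡ false
  edge-irrefl a rewrite ==-refl a with A a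
  ... | true  = refl
  ... | false = refl

  linked-realised : ∀ a b → linked a b ≡ true →
                    ∃[ u ] ∃[ v ] (branch a u ≡ true × branch b v ≡ true × adj G u v ≡ true)
  linked-realised a b ab with anyV⇒∃ _ ab
  ... | u , ab′ with anyV⇒∃ _ ab′
  ... | v , auv with ∧-true⇒ auv
  ... | au , buv with ∧-true⇒ buv
  ... | bv , uv = u , v , au , bv , uv

  edge-realised : ∀ a b → edge a b ≡ true →
                  ∃[ u ] ∃[ v ] (branch a u ≡ true × branch b v ≡ true × adj G u v ≡ true)
  edge-realised a b ab with ∧-true⇒ {A a} ab
  ... | _ , ab₁ with ∧-true⇒ {A b} ab₁
  ... | _ , ab₂ with ∧-true⇒ {not (a == b)} ab₂
  ... | _ , ab₃ with ∨-true⇒ {linked a b} ab₃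
  ... | inj₁ a→b = linked-realised a b a→b
  ... | inj₂ b→a with linked-realised b a b→a
  ... | u , v , bu , av , uv = v , u , av , bu , trans (Graph.sym G v u) uv

  edge-intro : ∀ {a b u v} → A a ≡ true → A b ≡ true → a ≢ b →
               branch a u ≡ true → branch b v ≡ true → adj G u v ≡ true → edge a b ≡ true
  edge-intro {a} {b} {u} {v} Aa Ab a≢b au bv uv =
    ∧-intro Aa (∧-intro Ab (∧-intro (cong not (≢⇒==-false a≢b)) (cong (_∨ linked b a) a→b)))
    where
    a→b : linked a b ≡ true
    a→b = ∃⇒anyV _ u (∃⇒anyV _ v (∧-intro au (∧-intro bv uv)))

  minor : RootedMinor G
  minor = record
    { vertex = A ; branch = branch ; edge = edge
    ; root∈branch = root∈branch ; branch-disjoint = branch-disjoint ; branch-connected = branch-connected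
    ; edge⇒vertex = λ a b ab → proj₁ (∧-true⇒ {A a} ab)
    ; edge-sym = edge-sym ; edge-irrefl = edge-irrefl ; edge-realised = edge-realised }

  private
    module M = RootedMinor minor

  branch-near : ∀ {u w} → A u ≡ true → W w ≡ true → Γ⁺ G u w ≡ true →
                ∃[ a ] (branch a w ≡ true × (a ≡ u ⊎ edge u a ≡ true))
  branch-near {u} {w} Au Ww uw with w ≟ u
  ... | yes refl = u , root∈branch u Au , inj₁ refl
  ... | no w≢u with ∨-true⇒ uw
  ... | inj₁ u≡w = ⊥-elim (w≢u (sym (==⇒≡ u≡w)))
  ... | inj₂ u-w = by-A (A w) refl
    where
    by-A : ∀ e → A w ≡ e → ∃[ a ] (branch a w ≡ true × (a ≡ u ⊎ edge u a ≡ true))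
    by-A true Aw = w , root∈branch w Aw ,
                   inj₂ (edge-intro Au Aw (w≢u ∘ sym) (root∈branch u Au) (root∈branch w Aw) u-w)
    by-A false ¬Aw with p w ≟ u
    ... | yes refl = p w , contracted∈branch w Ww ¬Aw , inj₁ refl
    ... | no pw≢u  = p w , contracted∈branch w Ww ¬Aw ,
                     inj₂ (edge-intro Au (p∈A w Ww) (pw≢u ∘ sym) (root∈branch u Au)
                                      (contracted∈branch w Ww ¬Aw) u-w)

  -- a branch set meets W in at most its root and one contracted vertex
  branch-size : ∀ a → ∑[ w < N ] 𝟙 (W w ∧ branch a w) ≤ 2
  branch-size a = begin
    ∑[ w < N ] 𝟙 (W w ∧ branch a w)                        ≤⟨ ∑-mono-≤ (λ w → root-or-contracted w _ refl) ⟩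
    ∑[ w < N ] (𝟙 (w == a) + 𝟙 (W w ∧ p w == a))           ≡⟨ ∑-distrib-+ (λ w → 𝟙 (w == a)) _ ⟩
    ∑[ w < N ] 𝟙 (w == a) + ∑[ w < N ] 𝟙 (W w ∧ p w == a)
      ≤⟨ +-mono-≤ (≤-reflexive (∑-δ₁ a)) (card-subsingleton _ unique) ⟩
    2                                                      ∎
    where
    open ≤-Reasoning
    root-or-contracted : ∀ w e → W w ∧ branch a w ≡ e → 𝟙 e ≤ 𝟙 (w == a) + 𝟙 (W w ∧ p w == a)
    root-or-contracted w false _ = z≤n
    root-or-contracted w true wa with branch-cases a w (proj₂ (∧-true⇒ {W w} wa))
    ... | _ , inj₁ refl = 1≤𝟙+ (==-refl w)
    ... | _ , inj₂ (Ww , _ , refl) = 1≤+𝟙 (∧-intro Ww (==-refl (p w)))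
    unique : ∀ w w′ → W w ∧ p w == a ≡ true → W w′ ∧ p w′ == a ≡ true → w ≡ w′
    unique w w′ wa w′a with ∧-true⇒ {W w} wa | ∧-true⇒ {W w′} w′a
    ... | Ww , pw≡a | Ww′ , pw′≡a = p-injective w w′ Ww Ww′ (trans (==⇒≡ pw≡a) (sym (==⇒≡ pw′≡a)))

  -- each w ∈ W ∩ Γ⁺(u) lies in the branch set of u or of a neighbour of u in the minor
  neighbourhood-size : ∀ {u} → A u ≡ true → ∑[ w < N ] 𝟙 (W w ∧ Γ⁺ G u w) ≤ suc (M.degree u) * 2
  neighbourhood-size {u} Au = begin
    ∑[ w < N ] 𝟙 (W w ∧ Γ⁺ G u w)                      ≤⟨ ∑-mono-≤ (λ w → covered w _ refl) ⟩
    ∑[ w < N ] ∑[ a < N ] (weight a * 𝟙 (W w ∧ branch a w)) ≡⟨ ∑-comm (λ w a → weight a * 𝟙 (W w ∧ branch a w)) ⟩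
    ∑[ a < N ] ∑[ w < N ] (weight a * 𝟙 (W w ∧ branch a w))
      ≡⟨ sum-cong-≗ (λ a → ∑-*ˡ (weight a) (λ w → 𝟙 (W w ∧ branch a w))) ⟩
    ∑[ a < N ] (weight a * ∑[ w < N ] 𝟙 (W w ∧ branch a w))
      ≤⟨ ∑-mono-≤ (λ a → *-monoʳ-≤ (weight a) (branch-size a)) ⟩
    ∑[ a < N ] (weight a * 2)                            ≡⟨ ∑-*ʳ weight 2 ⟩
    sum weight * 2
      ≡⟨ cong (_* 2) (trans (∑-distrib-+ (λ a → 𝟙 (a == u)) _) (cong (_+ M.degree u) (∑-δ₁ u))) ⟩
    suc (M.degree u) * 2                                 ∎
    where
    open ≤-Reasoning
    weight : Fin N → ℕ
    weight a = 𝟙 (a == u) + 𝟙 (edge u a)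
    covered : ∀ w e → W w ∧ Γ⁺ G u w ≡ e → 𝟙 e ≤ ∑[ a < N ] (weight a * 𝟙 (W w ∧ branch a w))
    covered w false _ = z≤n
    covered w true wu with ∧-true⇒ {W w} wu
    ... | Ww , uw with branch-near Au Ww uw
    ... | a , aw , near = ≤-trans (*-mono-≤ (weight-pos near) (≤-reflexive (sym (𝟙-true (∧-intro Ww aw)))))
                                  (≤∑ (λ a → weight a * 𝟙 (W w ∧ branch a w)) a)
      where
      weight-pos : ∀ {a} → a ≡ u ⊎ edge u a ≡ true → 1 ≤ weight a
      weight-pos (inj₁ refl) = 1≤𝟙+ (==-refl u)
      weight-pos (inj₂ ua)   = 1≤+𝟙 ua

  active-neighbourhoods : ∑[ u < N ] (if A u then ∑[ w < N ] 𝟙 (W w ∧ Γ⁺ G u w) else 0)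
                          ≤ (M.order + M.degreeSum) * 2
  active-neighbourhoods = begin
    ∑[ u < N ] (if A u then ∑[ w < N ] 𝟙 (W w ∧ Γ⁺ G u w) else 0) ≤⟨ ∑-mono-≤ (λ u → bound-at u _ refl) ⟩
    ∑[ u < N ] ((𝟙 (A u) + M.degree u) * 2)                       ≡⟨ ∑-*ʳ (λ u → 𝟙 (A u) + M.degree u) 2 ⟩
    (∑[ u < N ] (𝟙 (A u) + M.degree u)) * 2                       ≡⟨ cong (_* 2) (∑-distrib-+ (𝟙 ∘ A) M.degree) ⟩
    (M.order + M.degreeSum) * 2                                    ∎
    where
    open ≤-Reasoning
    bound-at : ∀ u e → A u ≡ e → (if e then ∑[ w < N ] 𝟙 (W w ∧ Γ⁺ G u w) else 0) ≤ (𝟙 e + M.degree u) * 2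
    bound-at u true  Au = neighbourhood-size Au
    bound-at u false _  = z≤n

-- Reverse delete

module _ {n} (G : Graph n) where

  deleteStep : VSet n → Fin n → VSet n
  deleteStep Y v = if isDominating G (remove Y v) then remove Y v else Y

  deleteStep-⊆ : ∀ Y v → deleteStep Y v ⊆ᵛ Y
  deleteStep-⊆ Y v x x∈ with isDominating G (remove Y v)
  ... | true  = proj₁ (∧-true⇒ x∈)
  ... | false = x∈

  deleteStep-keeps : ∀ Y v {x} → x ≢ v → Y x ≡ true → deleteStep Y v x ≡ true
  deleteStep-keeps Y v {x} x≢v Yx with isDominating G (remove Y v)
  ... | true  = ∧-intro Yx (cong not (≢⇒==-false (x≢v ∘ sym)))
  ... | false = Yx

  deleteStep-dominating : ∀ Y v → isDominating G Y ≡ true → isDominating G (deleteStep Y v) ≡ true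
  deleteStep-dominating Y v Y-dom with isDominating G (remove Y v) in dom
  ... | true  = dom
  ... | false = Y-dom

  reverseDelete'-⊆ : ∀ Y vs → reverseDelete' G Y vs ⊆ᵛ Y
  reverseDelete'-⊆ Y []       x x∈ = x∈
  reverseDelete'-⊆ Y (v ∷ vs) x x∈ = deleteStep-⊆ Y v x (reverseDelete'-⊆ (deleteStep Y v) vs x x∈)

  reverseDelete'-keeps : ∀ Y vs {x} → x ∉ vs → Y x ≡ true → reverseDelete' G Y vs x ≡ true
  reverseDelete'-keeps Y []       x∉ Yx = Yx
  reverseDelete'-keeps Y (v ∷ vs) x∉ Yx =
    reverseDelete'-keeps (deleteStep Y v) vs (x∉ ∘ there) (deleteStep-keeps Y v (x∉ ∘ here) Yx)

  reverseDelete'-dominating : ∀ Y vs → isDominating G Y ≡ true → isDominating G (reverseDelete' G Y vs) ≡ true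
  reverseDelete'-dominating Y []       Y-dom = Y-dom
  reverseDelete'-dominating Y (v ∷ vs) Y-dom =
    reverseDelete'-dominating (deleteStep Y v) vs (deleteStep-dominating Y v Y-dom)

  reverseDelete'-++ : ∀ Y us vs → reverseDelete' G Y (us ++ vs) ≡ reverseDelete' G (reverseDelete' G Y us) vs
  reverseDelete'-++ Y []       vs = refl
  reverseDelete'-++ Y (u ∷ us) vs = reverseDelete'-++ (deleteStep Y u) us vs

  -- w survived its own deletion step only because Y − w was not dominating
  step-survivor-has-private-neighbour : ∀ Y w vs → isDominating G Y ≡ true → reverseDelete' G Y (w ∷ vs) w ≡ true →
    ∃[ v ] (Γ⁺ G v w ≡ true × (∀ x → Y x ≡ true → Γ⁺ G v x ≡ true → x ≡ w))
  step-survivor-has-private-neighbour Y w vs Y-dom survives = by-step (isDominating G (remove Y w)) refl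
    where
    by-step : ∀ e → isDominating G (remove Y w) ≡ e →
              ∃[ v ] (Γ⁺ G v w ≡ true × (∀ x → Y x ≡ true → Γ⁺ G v x ≡ true → x ≡ w))
    by-step true dom rewrite dom with ∧-true⇒ {Y w} (reverseDelete'-⊆ (remove Y w) vs w survives)
    ... | _ , w∉ rewrite ==-refl w with () ← w∉
    by-step false ¬dom with allV-false⇒∃ _ ¬dom
    ... | v , undominated = v , Γ⁺vw , only-w
      where
      only-w : ∀ x → Y x ≡ true → Γ⁺ G v x ≡ true → x ≡ w
      only-w x Yx vx with x ≟ w
      ... | yes x≡w = x≡w
      ... | no  x≢w with () ← trans (sym (∧-intro (∧-intro Yx (cong not (≢⇒==-false (x≢w ∘ sym)))) vx))
                                     (anyV-false⇒∀ _ undominated x)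
      Γ⁺vw : Γ⁺ G v w ≡ true
      Γ⁺vw with anyV⇒∃ _ (allV⇒∀ _ Y-dom v)
      ... | x , x∈ with ∧-true⇒ {Y x} x∈
      ... | Yx , vx = subst (λ y → Γ⁺ G v y ≡ true) (only-w x Yx vx) vx

  survivor-has-private-neighbour : ∀ Y us w vs → isDominating G Y ≡ true →
    reverseDelete' G Y (us ++ w ∷ vs) w ≡ true →
    ∃[ v ] (Γ⁺ G v w ≡ true × (∀ x → reverseDelete' G Y us x ≡ true → Γ⁺ G v x ≡ true → x ≡ w))
  survivor-has-private-neighbour Y us w vs Y-dom survives =
    step-survivor-has-private-neighbour (reverseDelete' G Y us) w vs (reverseDelete'-dominating Y us Y-dom)
      (subst (λ Z → Z w ≡ true) (reverseDelete'-++ Y us (w ∷ vs)) survives)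

choose : ∀ {n} → (Fin n → Bool) → Fin n → Fin n
choose P default with Finₚ.any? (λ x → P x Boolₚ.≟ true)
... | yes (x , _) = x
... | no  _       = default

choose-satisfies : ∀ {n} (P : Fin n → Bool) default → ∃[ x ] P x ≡ true → P (choose P default) ≡ true
choose-satisfies P default ∃x with Finₚ.any? (λ x → P x Boolₚ.≟ true)
... | yes (_ , Px) = Px
... | no  ∄x       = ⊥-elim (∄x ∃x)

HoldsOnPrefix : ∀ {A : Set} → (A → Bool) → List A → Set
HoldsOnPrefix P xs = ∀ (i j : Fin (length xs)) → i Fin.< j → P (lookup xs j) ≡ true → P (lookup xs i) ≡ true

holdsOnPrefix-++ : ∀ {A : Set} {P : A → Bool} xs w {ys x} → HoldsOnPrefix P (xs ++ w ∷ ys) →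
                   x ∈ ys → P x ≡ true → P w ≡ true
holdsOnPrefix-++ {P = P} []       w prefix x∈ Px =
  prefix Fin.zero (Fin.suc (index x∈)) (s≤s z≤n) (subst (λ y → P y ≡ true) (lookup-index x∈) Px)
holdsOnPrefix-++ (_ ∷ xs) w prefix = holdsOnPrefix-++ xs w (λ i j i<j → prefix (Fin.suc i) (Fin.suc j) (s≤s i<j))

module Iteration {n} {G : Graph n} {c : Fin n → ℚ} (R : Run G c) (ord : List (Fin n))
                 (consistent : ConsistentOrder R ord) (i : ℕ) (i≤k : i ≤ k R) where

  X′ : VSet n
  X′ = X R (pred i)

  A : VSet n
  A = Active G X′

  Y : VSet n
  Y = reverseDelete R ord

  W : VSet n
  W = Y ─ X′

  X-mono : ∀ {j l} → j ≤ l → l ≤ k R → X R j ⊆ᵛ X R l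
  X-mono {l = zero}  z≤n    _   _ Xx = Xx
  X-mono {l = suc l} j≤1+l l<k x Xx with m≤n⇒m<n∨m≡n j≤1+l
  ... | inj₂ refl  = Xx
  ... | inj₁ j<1+l = Equivalence.from (Step.X'-def (steps R l l<k) x) (inj₁ (X-mono (≤-pred j<1+l) (<⇒≤ l<k) x Xx))

  X′⊆X-final : X′ ⊆ᵛ X R (k R)
  X′⊆X-final = X-mono (≤-trans pred[n]≤n i≤k) ≤-refl

  X-final-dominating : isDominating G (X R (k R)) ≡ true
  X-final-dominating = ∀⇒allV _ (λ v → not-false⇒ (halt R v))

  -- vertices of X′ are added no later than anything outside X′, so they are deleted no earlier
  X′-after : ∀ {us w vs} → reverse ord ≡ us ++ w ∷ vs → X′ w ≡ false → ∀ {x} → X′ x ≡ true → x ∉ us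
  X′-after {us} {w} {vs} split X′w X′x x∈us = true≢false (trans (sym X′w-holds) X′w)
    where
    ord-split : ord ≡ reverse vs ++ w ∷ reverse us
    ord-split = begin
      ord                          ≡⟨ sym (Listₚ.reverse-involutive ord) ⟩
      reverse (reverse ord)        ≡⟨ cong reverse split ⟩
      reverse (us ++ w ∷ vs)       ≡⟨ Listₚ.reverse-++ us (w ∷ vs) ⟩
      reverse (w ∷ vs) ++ reverse us ≡⟨ cong (_++ reverse us) (Listₚ.unfold-reverse w vs) ⟩
      (reverse vs ++ [ w ]) ++ reverse us ≡⟨ Listₚ.++-assoc (reverse vs) [ w ] (reverse us) ⟩
      reverse vs ++ w ∷ reverse us ∎
      where open ≡-Reasoning
    prefix : HoldsOnPrefix X′ ord
    prefix p q p<q = ConsistentOrder.consistent consistent p q p<q (pred i)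
    X′w-holds : X′ w ≡ true
    X′w-holds = holdsOnPrefix-++ (reverse vs) w (subst (HoldsOnPrefix X′) ord-split prefix) (reverse⁺ x∈us) X′x

  IsPrivateNeighbour : Fin n → Fin n → Bool
  IsPrivateNeighbour w v = A v ∧ (Γ⁺ G v w ∧ allV (λ x → not (Y x ∧ Γ⁺ G v x) ∨ x == w))

  isPrivateNeighbour⇒ : ∀ {w v} → IsPrivateNeighbour w v ≡ true →
    A v ≡ true × Γ⁺ G v w ≡ true × (∀ x → Y x ≡ true → Γ⁺ G v x ≡ true → x ≡ w)
  isPrivateNeighbour⇒ {w} {v} priv with ∧-true⇒ {A v} priv
  ... | Av , priv′ with ∧-true⇒ {Γ⁺ G v w} priv′
  ... | vw , only = Av , vw , λ x Yx vx → ==⇒≡ (or-w x (∧-intro Yx vx) (allV⇒∀ _ only x))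
    where
    or-w : ∀ x → Y x ∧ Γ⁺ G v x ≡ true → not (Y x ∧ Γ⁺ G v x) ∨ x == w ≡ true → x == w ≡ true
    or-w x x∈ rewrite x∈ = id

  ∃-privateNeighbour : ∀ w → W w ≡ true → ∃[ v ] IsPrivateNeighbour w v ≡ true
  ∃-privateNeighbour w Ww with ∧-true⇒ {Y w} Ww
  ... | Yw , ¬X′w′ with ∈-∃++ (reverse⁺ (Equivalence.from (ConsistentOrder.complete consistent w)
                                           (reverseDelete'-⊆ G _ (reverse ord) w Yw)))
  ... | us , vs , split with survivor-has-private-neighbour G (X R (k R)) us w vs X-final-dominating
                               (subst (λ zs → reverseDelete' G (X R (k R)) zs w ≡ true) split Yw)
  ... | v , vw , only = v , ∧-intro Av (∧-intro vw (∀⇒allV _ only-w))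
    where
    ¬X′w : X′ w ≡ false
    ¬X′w = not-true⇒ ¬X′w′
    Z : VSet n
    Z = reverseDelete' G (X R (k R)) us
    X′⊆Z : X′ ⊆ᵛ Z
    X′⊆Z x X′x = reverseDelete'-keeps G (X R (k R)) us (X′-after split ¬X′w X′x) (X′⊆X-final x X′x)
    Y⊆Z : Y ⊆ᵛ Z
    Y⊆Z x Yx = reverseDelete'-⊆ G Z (w ∷ vs) x
      (subst (λ S → S x ≡ true) (reverseDelete'-++ G (X R (k R)) us (w ∷ vs))
             (subst (λ zs → reverseDelete' G (X R (k R)) zs x ≡ true) split Yx))
    undominated : ∀ x → (X′ ∩ Γ⁺ G v) x ≡ false
    undominated x with X′ x in X′x | Γ⁺ G v x in vx
    ... | false | _     = refl
    ... | true  | false = refl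
    ... | true  | true  with only x (X′⊆Z x X′x) vx
    ... | refl with () ← trans (sym X′x) ¬X′w
    Av : A v ≡ true
    Av with anyV (X′ ∩ Γ⁺ G v) in dominated
    ... | false = refl
    ... | true  with anyV⇒∃ _ dominated
    ... | x , x∈ with () ← trans (sym x∈) (undominated x)
    only-w : ∀ x → not (Y x ∧ Γ⁺ G v x) ∨ x == w ≡ true
    only-w x with Y x in Yx | Γ⁺ G v x in vx
    ... | false | _     = refl
    ... | true  | false = refl
    ... | true  | true  = trans (cong (x ==_) (sym (only x (Y⊆Z x Yx) vx))) (==-refl x)

  privateNeighbour : Fin n → Fin n
  privateNeighbour w = choose (IsPrivateNeighbour w) w

  privateNeighbour-isPrivate : ∀ w → W w ≡ true → IsPrivateNeighbour w (privateNeighbour w) ≡ true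
  privateNeighbour-isPrivate w Ww = choose-satisfies (IsPrivateNeighbour w) w (∃-privateNeighbour w Ww)

  privateNeighbour∈A : ∀ w → W w ≡ true → A (privateNeighbour w) ≡ true
  privateNeighbour∈A w Ww = proj₁ (isPrivateNeighbour⇒ (privateNeighbour-isPrivate w Ww))

  w∈Γ⁺privateNeighbour : ∀ w → W w ≡ true → Γ⁺ G (privateNeighbour w) w ≡ true
  w∈Γ⁺privateNeighbour w Ww = proj₁ (proj₂ (isPrivateNeighbour⇒ (privateNeighbour-isPrivate w Ww)))

  privateNeighbour-injective : ∀ w w′ → W w ≡ true → W w′ ≡ true →
                               privateNeighbour w ≡ privateNeighbour w′ → w ≡ w′
  privateNeighbour-injective w w′ Ww Ww′ same =
    proj₂ (proj₂ (isPrivateNeighbour⇒ (privateNeighbour-isPrivate w′ Ww′))) w (proj₁ (∧-true⇒ {Y w} Ww))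
          (subst (λ v → Γ⁺ G v w ≡ true) same (w∈Γ⁺privateNeighbour w Ww))

  open ContractionOnto G A W privateNeighbour privateNeighbour∈A w∈Γ⁺privateNeighbour privateNeighbour-injective
    using (minor; active-neighbourhoods)
  open RootedMinor minor using (order; degreeSum)

  count-as-sum : sumVℕ (λ u → if A u then card (W ∩ Γ⁺ G u) else 0)
                 ≡ ∑[ u < n ] (if A u then ∑[ w < n ] 𝟙 (W w ∧ Γ⁺ G u w) else 0)
  count-as-sum = trans (sumVℕ≡∑ (λ u → if A u then card (W ∩ Γ⁺ G u) else 0))
                       (sum-cong-≗ (λ u → cong (if A u then_else 0) (card≡∑ (W ∩ Γ⁺ G u))))

  bound : ∀ {m} (H : Graph m) → ¬ (H ≼ G) →
          sumVℕ (λ u → if A u then card (W ∩ Γ⁺ G u) else 0) ≤ 2 * suc (cliqueDensity m) * card A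
  bound {m} H H⋠G = begin
    sumVℕ (λ u → if A u then card (W ∩ Γ⁺ G u) else 0)  ≡⟨ count-as-sum ⟩
    _                                                   ≤⟨ active-neighbourhoods ⟩
    (order + degreeSum) * 2
      ≤⟨ *-monoˡ-≤ 2 (+-monoʳ-≤ order (degreeSum-bounded H H⋠G minor)) ⟩
    (order + D * order) * 2
      ≡⟨ solve 2 (λ o d → (o :+ d :* o) :* con 2 := con 2 :* (con 1 :+ d) :* o) refl order D ⟩
    2 * suc D * order                                   ≡⟨ cong (2 * suc D *_) (sym (card≡∑ A)) ⟩
    2 * suc D * card A                                  ∎
    where
    open ≤-Reasoning
    open +-*-Solver using (solve; _:+_; _:*_; _:=_; con)
    D = cliqueDensity m

lemma2 : (𝒢 : Family) → MinorClosed 𝒢 → Proper 𝒢 →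
    ∃[ C ] (∀ n (G : Graph n) → 𝒢 n G →
      (c : Fin n → ℚ) → (∀ v → 0ℚ Q.≤ c v) →
      (R : Run G c) → (ord : List (Fin n)) → ConsistentOrder R ord →
      ∀ i → 1 ≤ i → i ≤ k R →
        sumVℕ (λ u → if Active G (X R (pred i)) u
                     then card ((reverseDelete R ord ─ X R (pred i)) ∩ Γ⁺ G u)
                     else 0)
        ≤ C * card (Active G (X R (pred i))))
lemma2 𝒢 minor-closed (m , H , H∉𝒢) =
  2 * suc (cliqueDensity m) , λ n G G∈𝒢 c _ R ord consistent i _ i≤k →
    Iteration.bound R ord consistent i i≤k H (H∉𝒢 ∘ minor-closed H G G∈𝒢)
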